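{- Suppose that $f$ satisfies the following: - every rule for $f$ is in de Simone format; - the target of every rule for $f$ is either a variable or of one of the forms $\mu.z$, $z+z'$, $z\parallel z'$, $f(z,z')$ with $z,z'$ distinct variables of the rule; - the equation $x\parallel y\approx f(x,y)+f(y,x)$ is sound modulo bisimilarity. Then the following two facts hold. (1) For at least one $\beta\in\{a,\bar a\}$, $f$ has a rule with premises $x_1\xrightarrow{\beta}y_1$ and $x_2\xrightarrow{\bar\beta}y_2$ and a conclusion of the form $f(x_1,x_2)\xrightarrow{\tau}t$. (2) For each $\mu\in\mathcal A$, $f$ has a rule with single premise $x_1\xrightarrow{\mu}y_1$ and a conclusion of the form $f(x_1,x_2)\xrightarrow{\mu}t$, or a rule with single premise $x_2\xrightarrow{\mu}y_2$ and a conclusion of the form $f(x_1,x_2)\xrightarrow{\mu}t$.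
   Context: Actions: $\mathcal A=\{a,\bar a,\tau\}$ with $a\ne\bar a$, $\bar{\bar a}=a$. CCS$_f$ terms: $t::=\mathbf 0\mid x\mid \mu.t\mid t+t\mid t\parallel t\mid f(t,t)$. The semantics is the labelled transition system on closed terms generated by the following rules, plus the rules for $f$: - $\mu.x\xrightarrow{\mu}x$; - from $x\xrightarrow{\mu}x'$ infer $x+y\xrightarrow{\mu}x'$, $y+x\xrightarrow{\mu}x'$, $x\parallel y\xrightarrow{\mu}x'\parallel y$ and $y\parallel x\xrightarrow{\mu}y\parallel x'$; - from $x\xrightarrow{\beta}x'$ and $y\xrightarrow{\bar\beta}y'$ ($\beta\in\{a,\bar a\}$) infer $x\parallel y\xrightarrow{\tau}x'\parallel y'$. A rule for $f$ is in de Simone format if it has premises $\{x_i\xrightarrow{\mu_i}y_i\mid i\in I\}$ with $I\subseteq\{1,2\}$ and conclusion $f(x_1,x_2)\xrightarrow{\mu}t$, where the variables $x_1,x_2,y_i$ are pairwise distinct, and $t$ is a term over these variables with each variable occurring at most once and with no $x_i$, $i\in I$, occurring. $\underline{\leftrightarrow}$ is strong bisimilarity on closed terms. An equation $t\approx u$ is sound if $\sigma(t)\,\underline{\leftrightarrow}\,\sigma(u)$ for all closed substitutions $\sigma$. -}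

module Defs where

open import Level using (Level; suc; zero)
open import Data.Empty using (⊥)
open import Data.Unit using (⊤)
open import Data.Bool using (Bool; true; false)
open import Data.Maybe using (Maybe; just; nothing)
open import Data.Nat using (ℕ; _+_; _≤_)
open import Data.Product using (Σ; _×_; _,_)
open import Data.Sum using (_⊎_)
open import Relation.Binary.PropositionalEquality using (_≡_)
open import Relation.Nullary using (¬_)

data Act : Set where
  a ā τ : Act

-- complement on visible actions (the value at τ is never used)
bar : Act → Act
bar a = ā
bar ā = a
bar τ = τ

data Term (V : Set) : Set where
  𝟘    : Term V
  var  : V → Term V
  _·_  : Act → Term V → Term V
  _⊕_  : Term V → Term V → Term V
  _∥_  : Term V → Term V → Term V
  f    : Term V → Term V → Term V

CTerm : Set
CTerm = Term ⊥

subst : {V W : Set} → (V → Term W) → Term V → Term W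
subst σ 𝟘 = 𝟘
subst σ (var x) = σ x
subst σ (μ · t) = μ · subst σ t
subst σ (t ⊕ u) = subst σ t ⊕ subst σ u
subst σ (t ∥ u) = subst σ t ∥ subst σ u
subst σ (f t u) = f (subst σ t) (subst σ u)

-- A rule has source variables x₁ x₂, target variables
-- y₁ y₂ (pairwise distinct by construction), an optional premise
-- x_i --μ_i--> y_i for i = 1,2 (nothing = i ∉ I), a conclusion label,
-- and a target term over the rule variables.

data RVar : Set where
  x₁ x₂ y₁ y₂ : RVar

record Rule : Set where
  constructor rule
  field
    prem₁  : Maybe Act
    prem₂  : Maybe Act
    label  : Act
    target : Term RVar
open Rule public

occ : RVar → Term RVar → ℕ
occ v 𝟘 = 0
occ x₁ (var x₁) = 1
occ x₂ (var x₂) = 1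
occ y₁ (var y₁) = 1
occ y₂ (var y₂) = 1
occ _  (var _)  = 0
occ v (μ · t) = occ v t
occ v (t ⊕ u) = occ v t + occ v u
occ v (t ∥ u) = occ v t + occ v u
occ v (f t u) = occ v t + occ v u

-- the variable condition attached to premise i:
-- if i ∈ I then x_i does not occur in the target,
-- if i ∉ I then y_i is not a variable of the rule, so does not occur.
PremVarOK : Maybe Act → RVar → RVar → Term RVar → Set
PremVarOK (just _) xi yi t = occ xi t ≡ 0
PremVarOK nothing  xi yi t = occ yi t ≡ 0

DeSimone : Rule → Set
DeSimone r =
  (∀ v → occ v (target r) ≤ 1)
  × PremVarOK (prem₁ r) x₁ y₁ (target r)
  × PremVarOK (prem₂ r) x₂ y₂ (target r)

SimpleTarget : Term RVar → Set
SimpleTarget 𝟘 = ⊥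
SimpleTarget (var _) = ⊤
SimpleTarget (μ · var _) = ⊤
SimpleTarget (μ · _) = ⊥
SimpleTarget (var z ⊕ var z') = ¬ (z ≡ z')
SimpleTarget (_ ⊕ _) = ⊥
SimpleTarget (var z ∥ var z') = ¬ (z ≡ z')
SimpleTarget (_ ∥ _) = ⊥
SimpleTarget (f (var z) (var z')) = ¬ (z ≡ z')
SimpleTarget (f _ _) = ⊥

RuleSet : Set₁
RuleSet = Rule → Set

inst : CTerm → CTerm → CTerm → CTerm → RVar → CTerm
inst p₁ p₂ q₁ q₂ x₁ = p₁
inst p₁ p₂ q₁ q₂ x₂ = p₂
inst p₁ p₂ q₁ q₂ y₁ = q₁
inst p₁ p₂ q₁ q₂ y₂ = q₂

module _ (R : RuleSet) where

  mutual
    data Step : CTerm → Act → CTerm → Set where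
      pre  : ∀ {μ p} → Step (μ · p) μ p
      sumˡ : ∀ {p q μ p'} → Step p μ p' → Step (p ⊕ q) μ p'
      sumʳ : ∀ {p q μ q'} → Step q μ q' → Step (p ⊕ q) μ q'
      parˡ : ∀ {p q μ p'} → Step p μ p' → Step (p ∥ q) μ (p' ∥ q)
      parʳ : ∀ {p q μ q'} → Step q μ q' → Step (p ∥ q) μ (p ∥ q')
      com  : ∀ {p q p' q' β} → (β ≡ a ⊎ β ≡ ā) →
             Step p β p' → Step q (bar β) q' → Step (p ∥ q) τ (p' ∥ q')
      frule : ∀ {r p₁ p₂ q₁ q₂} → R r →
              Prem (prem₁ r) p₁ q₁ → Prem (prem₂ r) p₂ q₂ →
              Step (f p₁ p₂) (label r) (subst (inst p₁ p₂ q₁ q₂) (target r))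

    -- premise x_i --μ--> y_i instantiated (no constraint when i ∉ I;
    -- then y_i does not occur in the target of a de Simone rule)
    data Prem : Maybe Act → CTerm → CTerm → Set where
      none : ∀ {p q} → Prem nothing p q
      some : ∀ {μ p q} → Step p μ q → Prem (just μ) p q

  IsBisimulation : (CTerm → CTerm → Set) → Set
  IsBisimulation B =
    (∀ {p q μ p'} → B p q → Step p μ p' → Σ CTerm λ q' → Step q μ q' × B p' q')
    × (∀ {p q μ q'} → B p q → Step q μ q' → Σ CTerm λ p' → Step p μ p' × B p' q')

  _↔_ : CTerm → CTerm → Set₁
  p ↔ q = Σ (CTerm → CTerm → Set) λ B → IsBisimulation B × B p q

  Sound : {V : Set} → Term V → Term V → Set₁
  Sound {V} t u = (σ : V → CTerm) → subst σ t ↔ subst σ u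

ParLHS ParRHS : Term Bool
ParLHS = var true ∥ var false
ParRHS = f (var true) (var false) ⊕ f (var false) (var true)

-- Only the actions enabled by the two sides of  x ∥ y ≈ f(x,y) + f(y,x)  are
-- compared, and only on the processes 𝟘 and μ.𝟘. A rule for f that fires on f(p₁,p₂) also fires on
-- f(trigger m₁, trigger m₂), where m_i is its i-th premise and
-- trigger m_i is the least process satisfying it (𝟘, or μ.𝟘). By the law,
-- trigger m₁ ∥ trigger m₂ then enables the label of the rule, which pins the
-- premises down. Applying this to the τ of a.𝟘 ∥ ā.𝟘 gives (1), and to the μ
-- of μ.𝟘 ∥ 𝟘 gives (2).
module Submission where

open import Defs
open import Data.Bool using (if_then_else_)
open import Data.Maybe using (Maybe; just; nothing)
open import Data.Product using (Σ; _×_; _,_)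
open import Data.Sum using (_⊎_; inj₁; inj₂)
open import Relation.Binary.PropositionalEquality using (_≡_; refl)
open import Relation.Nullary using (¬_; contradiction)

trigger : Maybe Act → CTerm
trigger nothing  = 𝟘
trigger (just μ) = μ · 𝟘

_⊑_ : Maybe Act → Maybe Act → Set
m ⊑ n = m ≡ nothing ⊎ m ≡ n

⊑-just-agree : ∀ {m ν μ} → m ⊑ just ν → m ≡ just μ → ν ≡ μ
⊑-just-agree (inj₂ refl) refl = refl

⊑-nothing : ∀ {m} → m ⊑ nothing → m ≡ nothing
⊑-nothing (inj₁ e) = e
⊑-nothing (inj₂ e) = e

absent≢just : ∀ {m : Maybe Act} {μ} → m ≡ nothing → ¬ m ≡ just μ
absent≢just refl ()

Complementary : Maybe Act → Maybe Act → Set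
Complementary m₁ m₂ =
  Σ Act λ β → (β ≡ a ⊎ β ≡ ā) × m₁ ≡ just β × m₂ ≡ just (bar β)

module _ (R : RuleSet) where

  Enabled : CTerm → Act → Set
  Enabled p μ = Σ CTerm (Step R p μ)

  ↔-enabled : ∀ {p q μ} → _↔_ R p q → Enabled p μ → Enabled q μ
  ↔-enabled (_ , (forth , _) , pBq) (_ , s) with forth pBq s
  ... | q′ , t , _ = q′ , t

  ↔-enabled⁻ : ∀ {p q μ} → _↔_ R p q → Enabled q μ → Enabled p μ
  ↔-enabled⁻ (_ , (_ , back) , pBq) (_ , t) with back pBq t
  ... | p′ , s , _ = p′ , s

  par-law : Sound R ParLHS ParRHS → ∀ p q → _↔_ R (p ∥ q) (f p q ⊕ f q p)
  par-law sound p q = sound (λ b → if b then p else q)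

  f-enabled-of-par : Sound R ParLHS ParRHS → ∀ {p q μ} →
    Enabled (p ∥ q) μ → Enabled (f p q) μ ⊎ Enabled (f q p) μ
  f-enabled-of-par sound {p} {q} e with ↔-enabled (par-law sound p q) e
  ... | p′ , sumˡ s = inj₁ (p′ , s)
  ... | q′ , sumʳ s = inj₂ (q′ , s)

  par-enabled-of-f : Sound R ParLHS ParRHS → ∀ {p q μ} →
    Enabled (f p q) μ → Enabled (p ∥ q) μ
  par-enabled-of-f sound {p} {q} (s′ , s) = ↔-enabled⁻ (par-law sound p q) (s′ , sumˡ s)

  trigger-satisfies : ∀ m → Σ CTerm (Prem R m (trigger m))
  trigger-satisfies nothing  = 𝟘 , none
  trigger-satisfies (just μ) = 𝟘 , some pre

  prem-of-trigger : ∀ {m n q} → Prem R m (trigger n) q → m ⊑ n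
  prem-of-trigger none = inj₁ refl
  prem-of-trigger {n = just μ} (some pre) = inj₂ refl

  step-of-trigger : ∀ {m μ p} → Step R (trigger m) μ p → m ≡ just μ
  step-of-trigger {just μ} pre = refl

  par-triggers-enabled : ∀ {m₁ m₂ μ} → Enabled (trigger m₁ ∥ trigger m₂) μ →
    m₁ ≡ just μ ⊎ m₂ ≡ just μ ⊎ (Complementary m₁ m₂ × μ ≡ τ)
  par-triggers-enabled (_ , parˡ s) = inj₁ (step-of-trigger s)
  par-triggers-enabled (_ , parʳ s) = inj₂ (inj₁ (step-of-trigger s))
  par-triggers-enabled (_ , com v s t) =
    inj₂ (inj₂ ((_ , v , step-of-trigger s , step-of-trigger t) , refl))

  record FiringRule (n₁ n₂ : Maybe Act) (μ : Act) : Set where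
    field
      rule-of  : Rule
      in-R     : R rule-of
      labelled : label rule-of ≡ μ
      prem₁⊑   : prem₁ rule-of ⊑ n₁
      prem₂⊑   : prem₂ rule-of ⊑ n₂
      shape    : prem₁ rule-of ≡ just μ ⊎ prem₂ rule-of ≡ just μ
                   ⊎ (Complementary (prem₁ rule-of) (prem₂ rule-of) × μ ≡ τ)

  firing-rule : Sound R ParLHS ParRHS → ∀ {n₁ n₂ μ} →
    Enabled (f (trigger n₁) (trigger n₂)) μ → FiringRule n₁ n₂ μ
  firing-rule sound (_ , frule {r} r∈R P₁ P₂) = record
    { rule-of = r ; in-R = r∈R ; labelled = refl
    ; prem₁⊑ = prem-of-trigger P₁ ; prem₂⊑ = prem-of-trigger P₂
    ; shape = par-triggers-enabled (par-enabled-of-f sound fires-on-triggers) }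
    where
    fires-on-triggers : Enabled (f (trigger (prem₁ r)) (trigger (prem₂ r))) (label r)
    fires-on-triggers with trigger-satisfies (prem₁ r) | trigger-satisfies (prem₂ r)
    ... | _ , Q₁ | _ , Q₂ = _ , frule r∈R Q₁ Q₂

  open FiringRule

  CommunicationRule : Set
  CommunicationRule = Σ Act λ β → (β ≡ a ⊎ β ≡ ā) × (Σ Rule λ r → R r
    × prem₁ r ≡ just β × prem₂ r ≡ just (bar β) × label r ≡ τ)

  SinglePremiseRule : Act → Set
  SinglePremiseRule μ = Σ Rule λ r → R r
    × ((prem₁ r ≡ just μ × prem₂ r ≡ nothing × label r ≡ μ)
       ⊎ (prem₁ r ≡ nothing × prem₂ r ≡ just μ × label r ≡ μ))

  τ-firing-on-visible : ∀ {ν₁ ν₂} → ¬ ν₁ ≡ τ → ¬ ν₂ ≡ τ →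
    FiringRule (just ν₁) (just ν₂) τ → CommunicationRule
  τ-firing-on-visible ν₁≢τ ν₂≢τ F with shape F
  ... | inj₁ e = contradiction (⊑-just-agree (prem₁⊑ F) e) ν₁≢τ
  ... | inj₂ (inj₁ e) = contradiction (⊑-just-agree (prem₂⊑ F) e) ν₂≢τ
  ... | inj₂ (inj₂ ((β , visible , e₁ , e₂) , _)) =
    β , visible , rule-of F , in-R F , e₁ , e₂ , labelled F

  firing-on-first : ∀ {μ} → FiringRule (just μ) nothing μ → SinglePremiseRule μ
  firing-on-first F with shape F | ⊑-nothing (prem₂⊑ F)
  ... | inj₁ e | absent = rule-of F , in-R F , inj₁ (e , absent , labelled F)
  ... | inj₂ (inj₁ e) | absent = contradiction e (absent≢just absent)
  ... | inj₂ (inj₂ ((_ , _ , _ , e) , _)) | absent = contradiction e (absent≢just absent)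

  firing-on-second : ∀ {μ} → FiringRule nothing (just μ) μ → SinglePremiseRule μ
  firing-on-second F with shape F | ⊑-nothing (prem₁⊑ F)
  ... | inj₁ e | absent = contradiction e (absent≢just absent)
  ... | inj₂ (inj₁ e) | absent = rule-of F , in-R F , inj₂ (absent , e , labelled F)
  ... | inj₂ (inj₂ ((_ , _ , e , _) , _)) | absent = contradiction e (absent≢just absent)

  communication-rule : Sound R ParLHS ParRHS → CommunicationRule
  communication-rule sound with f-enabled-of-par sound (_ , com (inj₁ refl) pre pre)
  ... | inj₁ e = τ-firing-on-visible (λ ()) (λ ()) (firing-rule sound {just a} {just ā} e)
  ... | inj₂ e = τ-firing-on-visible (λ ()) (λ ()) (firing-rule sound {just ā} {just a} e)

  single-premise-rule : Sound R ParLHS ParRHS → ∀ μ → SinglePremiseRule μ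
  single-premise-rule sound μ with f-enabled-of-par sound {μ · 𝟘} {𝟘} (_ , parˡ pre)
  ... | inj₁ e = firing-on-first (firing-rule sound {just μ} {nothing} e)
  ... | inj₂ e = firing-on-second (firing-rule sound {nothing} {just μ} e)

proposition3 : (R : RuleSet)
    → (∀ r → R r → DeSimone r)
    → (∀ r → R r → SimpleTarget (target r))
    → Sound R ParLHS ParRHS
    → (Σ Act λ β → (β ≡ a ⊎ β ≡ ā) × (Σ Rule λ r → R r
         × prem₁ r ≡ just β × prem₂ r ≡ just (bar β) × label r ≡ τ))
      × (∀ μ → Σ Rule λ r → R r
         × ((prem₁ r ≡ just μ × prem₂ r ≡ nothing × label r ≡ μ)
            ⊎ (prem₁ r ≡ nothing × prem₂ r ≡ just μ × label r ≡ μ)))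
proposition3 R _ _ sound = communication-rule R sound , single-premise-rule R sound
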